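{- Let $L$ and $R$ be nonempty subsets of a group $G$. If $G=\mathcal{W}(\bar{L})\mathcal{W}(\bar{R})$ and $k$ is the minimum weak connection length in $G$ relative to $(L,R)$, then the two-sided group digraph $2\mathrm{S}(G;L,R)$ has exactly $k$ weakly connected components (infinitely many if $k$ is infinite), all of the same size. Moreover, if $L\cap N_G(L)\neq\emptyset$ or $R\cap N_G(R)\neq\emptyset$, then all weakly connected components are isomorphic as digraphs.
   Context: For a group $G$ with identity $e$ and nonempty subsets $L,R\subseteq G$, the two-sided group digraph $2\mathrm{S}(G;L,R)$ has vertex set $G$ and a directed arc $(g,h)$ if and only if $h=l^{ -1}gr$ for some $l\in L$, $r\in R$. A vertex $g$ is weakly connected to $h$ (written $g\sim h$) if there is a sequence $g=g_0,g_1,\dots,g_n=h$ such that for each $i$ either $(g_{i-1},g_i)$ or $(g_i,g_{i-1})$ is an arc; weakly connected components are the classes of this equivalence relation. For a nonempty subset $S\subseteq G$, a word in $S$ of length $n>0$ is a product $s_1\cdots s_n$ with all $s_i\in S$, and $\mathcal{W}(S)$ is the set of elements of $G$ given by words in $S$ of finite positive length. Write $S^{ -1}=\{s^{ -1}:s\in S\}$, $\bar{L}=L\cup L^{ -1}$, $\bar{R}=R\cup R^{ -1}$, and $AB=\{ab:a\in A,b\in B\}$. The minimum weak connection length in $G$ relative to $(L,R)$ is the minimum $k\geq 1$ such that some element given by a word of length $k$ purely in $L$, or purely in $L^{ -1}$, or purely in $R$, or purely in $R^{ -1}$, is weakly connected to $e$ in $2\mathrm{S}(G;L,R)$; it is infinite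 if no such word exists. For a subset $X\subseteq G$, $N_G(X)=\{g\in G: gXg^{ -1}=X\}$. -}

module Defs where

open import Level using (Level; _⊔_)
open import Algebra.Bundles using (Group)
open import Data.Nat using (ℕ; suc; _≤_; _<_)
open import Data.Fin using (Fin)
open import Data.Vec using (Vec; foldr)
open import Data.Vec.Relation.Unary.All using (All)
open import Data.Product using (Σ; ∃; ∃-syntax; _×_; proj₁)
open import Data.Sum using (_⊎_)
open import Relation.Nullary using (¬_)
open import Relation.Unary using (Pred)
open import Relation.Binary using (Setoid; _Respects_)
open import Relation.Binary.PropositionalEquality using (_≡_)
open import Relation.Binary.Construct.Closure.Equivalence using (EqClosure)
import Relation.Binary.Construct.On as On
open import Function.Bundles using (Func; Bijection)

module _ {c ℓ : Level} (G : Group c ℓ) where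
  open Group G

  private
    variable
      p : Level

  IsSubset : Pred Carrier p → Set (c ⊔ ℓ ⊔ p)
  IsSubset S = S Respects _≈_

  InvSet : Pred Carrier p → Pred Carrier (c ⊔ ℓ ⊔ p)
  InvSet S x = ∃[ s ] (S s × x ≈ s ⁻¹)

  Bar : Pred Carrier p → Pred Carrier (c ⊔ ℓ ⊔ p)
  Bar S x = S x ⊎ InvSet S x

  prod : {n : ℕ} → Vec Carrier n → Carrier
  prod = foldr _ _∙_ ε

  WordOfLength : {q : Level} → Pred Carrier q → ℕ → Pred Carrier (c ⊔ ℓ ⊔ q)
  WordOfLength S n x = Σ (Vec Carrier n) (λ ws → All S ws × prod ws ≈ x)

  𝒲 : {q : Level} → Pred Carrier q → Pred Carrier (c ⊔ ℓ ⊔ q)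
  𝒲 S x = ∃[ n ] WordOfLength S (suc n) x

  Arc : Pred Carrier p → Pred Carrier p → Carrier → Carrier → Set (c ⊔ ℓ ⊔ p)
  Arc L R g h = ∃[ l ] ∃[ r ] (L l × R r × h ≈ (l ⁻¹ ∙ g) ∙ r)

  WeaklyConnected : Pred Carrier p → Pred Carrier p → Carrier → Carrier → Set (c ⊔ ℓ ⊔ p)
  WeaklyConnected L R = EqClosure (Arc L R)

  HasWeakConnLength : Pred Carrier p → Pred Carrier p → ℕ → Set (c ⊔ ℓ ⊔ p)
  HasWeakConnLength L R k =
    ∃[ x ] ((WordOfLength L k x ⊎ WordOfLength (InvSet L) k x
             ⊎ WordOfLength R k x ⊎ WordOfLength (InvSet R) k x)
            × WeaklyConnected L R x ε)

  IsMinWeakConnLength : Pred Carrier p → Pred Carrier p → ℕ → Set (c ⊔ ℓ ⊔ p)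
  IsMinWeakConnLength L R k =
    1 ≤ k × HasWeakConnLength L R k
    × (∀ j → 1 ≤ j → j < k → ¬ HasWeakConnLength L R j)

  InfiniteWeakConnLength : Pred Carrier p → Pred Carrier p → Set (c ⊔ ℓ ⊔ p)
  InfiniteWeakConnLength L R = ∀ k → 1 ≤ k → ¬ HasWeakConnLength L R k

  HasExactlyComponents : Pred Carrier p → Pred Carrier p → ℕ → Set (c ⊔ ℓ ⊔ p)
  HasExactlyComponents L R k =
    Σ (Fin k → Carrier) λ rep →
      (∀ i j → WeaklyConnected L R (rep i) (rep j) → i ≡ j)
      × (∀ g → ∃[ i ] WeaklyConnected L R g (rep i))

  HasInfinitelyManyComponents : Pred Carrier p → Pred Carrier p → Set (c ⊔ ℓ ⊔ p)
  HasInfinitelyManyComponents L R =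
    Σ (ℕ → Carrier) λ f → ∀ m n → WeaklyConnected L R (f m) (f n) → m ≡ n

  Component : Pred Carrier p → Pred Carrier p → Carrier → Setoid (c ⊔ ℓ ⊔ p) ℓ
  Component L R g = On.setoid {B = Σ Carrier (λ x → WeaklyConnected L R x g)} setoid proj₁

  SameSize : Pred Carrier p → Pred Carrier p → Carrier → Carrier → Set (c ⊔ ℓ ⊔ p)
  SameSize L R g h = Bijection (Component L R g) (Component L R h)

  IsomorphicComponents : Pred Carrier p → Pred Carrier p → Carrier → Carrier → Set (c ⊔ ℓ ⊔ p)
  IsomorphicComponents L R g h =
    Σ (Bijection (Component L R g) (Component L R h)) λ f →
      ∀ x y → (Arc L R (proj₁ x) (proj₁ y) → Arc L R (proj₁ (Bijection.to f x)) (proj₁ (Bijection.to f y)))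
            × (Arc L R (proj₁ (Bijection.to f x)) (proj₁ (Bijection.to f y)) → Arc L R (proj₁ x) (proj₁ y))

  Normalizer : Pred Carrier p → Pred Carrier (c ⊔ ℓ ⊔ p)
  Normalizer X g =
    (∀ x → X x → X ((g ∙ x) ∙ g ⁻¹))
    × (∀ y → X y → ∃[ x ] (X x × y ≈ (g ∙ x) ∙ g ⁻¹))

module Submission where

-- Fix l₀ ∈ L, r₀ ∈ R, write x ~ y for weak connectivity and let σ x = x r₀,
-- σ⁻ x = x r₀⁻¹ (the shift).  The proof rests on three observations.
--  (1) Every single step is imitated by the shift: l x ~ σ x, l⁻¹ x ~ σ⁻ x,
--      x r ~ σ x and x r⁻¹ ~ σ⁻ x for l ∈ L, r ∈ R; and σ, σ⁻ preserve ~.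
--  (2) Because G = 𝒲(L̄)𝒲(R̄), every vertex is reached from e by left
--      multiplications by L̄ and right multiplications by R̄ ('generated');
--      with (1), a ~-closed property of vertices that holds at e and is
--      stable under σ and σ⁻ holds everywhere ('everywhere').
--  (3) Words of length n in L or R act like σⁿ, words in L⁻¹ or R⁻¹ like σ⁻ⁿ,
--      so the connection length is the least k ≥ 1 with σᵏ e ~ e.  Then
--      e, σ e, …, σᵏ⁻¹ e are pairwise unconnected and, by (2), meet every
--      component; if k is infinite all σⁿ e are pairwise unconnected.
-- For the shape of the components we use automorphisms (of ~, or of the arc
-- relation): one carrying g into the component of h maps that component of g
-- onto the one of h.  Composites of an automorphism that shadows σ reach every
-- component from e, by (2).  The shift is a ~-automorphism (equal sizes);
-- multiplication by a normalising element of L or R is a digraph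
-- automorphism shadowing σ (isomorphic components).

open import Defs
open import Level using (Level; _⊔_)
open import Algebra.Bundles using (Group)
import Algebra.Properties.Group as GroupProperties
import Data.Nat as ℕ
open import Data.Nat using (ℕ; zero; suc; _≤_; _<_; s≤s; s≤s⁻¹; z≤n; z<s)
open import Data.Nat.Properties using (≤-refl; ≤-<-trans; m≤n⇒m≤1+n; ⊔-lub; _≟_; ≤∧≢⇒<; n<1+n; <-trans)
open import Data.Nat.GeneralisedArithmetic using (fold)
open import Data.Fin using (Fin; toℕ; fromℕ<)
open import Data.Fin.Properties using (toℕ-injective; toℕ<n; toℕ-fromℕ<)
open import Data.Empty using (⊥-elim)
open import Data.Product using (∃-syntax; Σ-syntax; _×_; _,_; proj₁; proj₂)
open import Data.Sum using (_⊎_; inj₁; inj₂)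
open import Data.Vec using (Vec; []; _∷_; replicate)
open import Data.Vec.Relation.Unary.All using (All; []; _∷_)
open import Relation.Nullary using (yes; no)
open import Relation.Unary using (Pred)
open import Relation.Binary using (Rel; Setoid; _Preserves_⟶_; _Respects_)
import Relation.Binary.PropositionalEquality as ≡
import Relation.Binary.Construct.Closure.Equivalence as EqClosure
import Relation.Binary.Reasoning.Setoid as SetoidReasoning

module _ {a} {A : Set a} where

  fold-preserves : ∀ {r} (_∼_ : Rel A r) {f : A → A} →
                   f Preserves _∼_ ⟶ _∼_ → ∀ n → (λ z → fold z f n) Preserves _∼_ ⟶ _∼_
  fold-preserves _∼_ f-pres zero    z∼w = z∼w
  fold-preserves _∼_ f-pres (suc n) z∼w = f-pres (fold-preserves _∼_ f-pres n z∼w)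

  fold-commute : ∀ (f : A → A) z n → fold (f z) f n ≡.≡ f (fold z f n)
  fold-commute f z zero    = ≡.refl
  fold-commute f z (suc n) = ≡.cong f (fold-commute f z n)

fold-cancel : ∀ {a ℓ} (S : Setoid a ℓ) {f g : Setoid.Carrier S → Setoid.Carrier S} →
              f Preserves Setoid._≈_ S ⟶ Setoid._≈_ S → (∀ x → Setoid._≈_ S (f (g x)) x) →
              ∀ n z → Setoid._≈_ S (fold (fold z g n) f n) z
fold-cancel S f-cong fg zero    z = Setoid.refl S
fold-cancel S {f} {g} f-cong fg (suc n) z = begin
  f (fold (g y) f n)   ≡⟨ fold-commute f (g y) n ⟨
  fold (f (g y)) f n   ≈⟨ fold-preserves (Setoid._≈_ S) f-cong n (fg y) ⟩
  fold y f n           ≈⟨ fold-cancel S f-cong fg n z ⟩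
  z                    ∎
  where
  open SetoidReasoning S
  y = fold z g n

record Automorphism {a ℓ r} (S : Setoid a ℓ) (_∼_ : Rel (Setoid.Carrier S) r) : Set (a ⊔ ℓ ⊔ r) where
  open Setoid S
  field
    to from        : Carrier → Carrier
    to-cong        : to Preserves _≈_ ⟶ _≈_
    from-cong      : from Preserves _≈_ ⟶ _≈_
    from-to        : ∀ x → from (to x) ≈ x
    to-from        : ∀ x → to (from x) ≈ x
    to-preserves   : to Preserves _∼_ ⟶ _∼_
    from-preserves : from Preserves _∼_ ⟶ _∼_

module _ {a ℓ r} {S : Setoid a ℓ} {_∼_ : Rel (Setoid.Carrier S) r} where
  open Setoid S
  open Automorphism

  idᵃ : Automorphism S _∼_
  idᵃ .to x = x
  idᵃ .from x = x
  idᵃ .to-cong x≈y = x≈y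
  idᵃ .from-cong x≈y = x≈y
  idᵃ .from-to _ = refl
  idᵃ .to-from _ = refl
  idᵃ .to-preserves x∼y = x∼y
  idᵃ .from-preserves x∼y = x∼y

  infix 10 _⁻¹ᵃ
  _⁻¹ᵃ : Automorphism S _∼_ → Automorphism S _∼_
  (τ ⁻¹ᵃ) .to = τ .from
  (τ ⁻¹ᵃ) .from = τ .to
  (τ ⁻¹ᵃ) .to-cong = τ .from-cong
  (τ ⁻¹ᵃ) .from-cong = τ .to-cong
  (τ ⁻¹ᵃ) .from-to = τ .to-from
  (τ ⁻¹ᵃ) .to-from = τ .from-to
  (τ ⁻¹ᵃ) .to-preserves = τ .from-preserves
  (τ ⁻¹ᵃ) .from-preserves = τ .to-preserves

  infixr 9 _∘ᵃ_
  _∘ᵃ_ : Automorphism S _∼_ → Automorphism S _∼_ → Automorphism S _∼_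
  (τ ∘ᵃ υ) .to x = τ .to (υ .to x)
  (τ ∘ᵃ υ) .from x = υ .from (τ .from x)
  (τ ∘ᵃ υ) .to-cong x≈y = τ .to-cong (υ .to-cong x≈y)
  (τ ∘ᵃ υ) .from-cong x≈y = υ .from-cong (τ .from-cong x≈y)
  (τ ∘ᵃ υ) .from-to x = trans (υ .from-cong (τ .from-to _)) (υ .from-to x)
  (τ ∘ᵃ υ) .to-from x = trans (τ .to-cong (υ .to-from _)) (τ .to-from x)
  (τ ∘ᵃ υ) .to-preserves x∼y = τ .to-preserves (υ .to-preserves x∼y)
  (τ ∘ᵃ υ) .from-preserves x∼y = υ .from-preserves (τ .from-preserves x∼y)

module GroupFacts {c ℓ p} (G : Group c ℓ) (L R : Pred (Group.Carrier G) p) where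
  open Group G
  open GroupProperties G
  open SetoidReasoning setoid

  Factorisation : Set (c ⊔ ℓ ⊔ p)
  Factorisation = (g : Carrier) → Σ[ a ∈ Carrier ] Σ[ b ∈ Carrier ]
                    (𝒲 G (Bar G L) a × 𝒲 G (Bar G R) b × g ≈ a ∙ b)

  generated : Factorisation → ∀ {q} (P : Pred Carrier q) → P Respects _≈_ →
              (∀ {l y} → L l → P y → P (l ∙ y)) → (∀ {l y} → L l → P y → P (l ⁻¹ ∙ y)) →
              (∀ {r y} → R r → P y → P (y ∙ r)) → (∀ {r y} → R r → P y → P (y ∙ r ⁻¹)) →
              P ε → ∀ g → P g
  generated fact P P-resp stepˡ stepˡ⁻¹ stepʳ stepʳ⁻¹ Pε g
    with fact g
  ... | a , b , (_ , us , L̄us , us≈a) , (_ , vs , R̄vs , vs≈b) , g≈ab =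
    P-resp (trans (∙-cong us≈a (trans (identityˡ _) vs≈b)) (sym g≈ab))
           (leftWord L̄us (rightWord R̄vs Pε))
    where
    leftWord : ∀ {n} {ws : Vec Carrier n} {y} → All (Bar G L) ws → P y → P (prod G ws ∙ y)
    leftWord [] Py = P-resp (sym (identityˡ _)) Py
    leftWord (inj₁ Lw ∷ L̄ws) Py = P-resp (sym (assoc _ _ _)) (stepˡ Lw (leftWord L̄ws Py))
    leftWord (inj₂ (_ , Ls , w≈s⁻¹) ∷ L̄ws) Py =
      P-resp (trans (∙-congʳ (sym w≈s⁻¹)) (sym (assoc _ _ _))) (stepˡ⁻¹ Ls (leftWord L̄ws Py))

    rightWord : ∀ {n} {ws : Vec Carrier n} {y} → All (Bar G R) ws → P y → P (y ∙ prod G ws)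
    rightWord [] Py = P-resp (sym (identityʳ _)) Py
    rightWord (inj₁ Rw ∷ R̄ws) Py = P-resp (assoc _ _ _) (rightWord R̄ws (stepʳ Rw Py))
    rightWord (inj₂ (_ , Rs , w≈s⁻¹) ∷ R̄ws) Py =
      P-resp (trans (∙-congʳ (∙-congˡ (sym w≈s⁻¹))) (assoc _ _ _)) (rightWord R̄ws (stepʳ⁻¹ Rs Py))

  PassesLeft : Pred Carrier p → Carrier → Set (c ⊔ ℓ ⊔ p)
  PassesLeft X u = ∀ {x} → X x → ∃[ x' ] (X x' × x' ∙ u ≈ u ∙ x)

  PassesRight : Pred Carrier p → Carrier → Set (c ⊔ ℓ ⊔ p)
  PassesRight X u = ∀ {x} → X x → ∃[ x' ] (X x' × x ∙ u ≈ u ∙ x')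

  conjugate-right : ∀ {n x y} → y ≈ (n ∙ x) ∙ n ⁻¹ → y ∙ n ≈ n ∙ x
  conjugate-right {n} {x} y≈ = trans (∙-congʳ y≈) (//-rightDividesˡ n (n ∙ x))

  conjugate-left : ∀ {n x y} → y ≈ (n ∙ x) ∙ n ⁻¹ → n ⁻¹ ∙ y ≈ x ∙ n ⁻¹
  conjugate-left {n} {x} {y} y≈ = begin
    n ⁻¹ ∙ y                 ≈⟨ ∙-congˡ (trans y≈ (assoc n x (n ⁻¹))) ⟩
    n ⁻¹ ∙ (n ∙ (x ∙ n ⁻¹))  ≈⟨ \\-leftDividesʳ n (x ∙ n ⁻¹) ⟩
    x ∙ n ⁻¹                 ∎

  module _ {X : Pred Carrier p} {n : Carrier} (normal : Normalizer G X n) where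
    private
      conjugate-in = proj₁ normal
      conjugate-of = proj₂ normal

    normaliser-passesLeft : PassesLeft X n
    normaliser-passesLeft Xx = _ , conjugate-in _ Xx , conjugate-right refl

    normaliser-passesRight : PassesRight X n
    normaliser-passesRight Xy with conjugate-of _ Xy
    ... | x , Xx , y≈ = x , Xx , conjugate-right y≈

    normaliser⁻¹-passesLeft : PassesLeft X (n ⁻¹)
    normaliser⁻¹-passesLeft Xy with conjugate-of _ Xy
    ... | x , Xx , y≈ = x , Xx , sym (conjugate-left y≈)

    normaliser⁻¹-passesRight : PassesRight X (n ⁻¹)
    normaliser⁻¹-passesRight Xx = _ , conjugate-in _ Xx , sym (conjugate-left refl)

  swap-inverses : ∀ {a b u} → a ∙ u ≈ u ∙ b → u ∙ b ⁻¹ ≈ a ⁻¹ ∙ u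
  swap-inverses {a} {b} {u} au≈ub = begin
    u ∙ b ⁻¹                ≈⟨ \\-leftDividesʳ a (u ∙ b ⁻¹) ⟨
    a ⁻¹ ∙ (a ∙ (u ∙ b ⁻¹))  ≈⟨ ∙-congˡ (assoc a u (b ⁻¹)) ⟨
    a ⁻¹ ∙ ((a ∙ u) ∙ b ⁻¹)  ≈⟨ ∙-congˡ (∙-congʳ au≈ub) ⟩
    a ⁻¹ ∙ ((u ∙ b) ∙ b ⁻¹)  ≈⟨ ∙-congˡ (//-rightDividesʳ b u) ⟩
    a ⁻¹ ∙ u                ∎

  arc-leftMultiplication : ∀ {u} → PassesLeft L u → ∀ {x y} → Arc G L R x y → Arc G L R (u ∙ x) (u ∙ y)
  arc-leftMultiplication {u} passes {x} {y} (l , r , Ll , Rr , y≈) with passes Ll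
  ... | l' , Ll' , l'u≈ul = l' , r , Ll' , Rr , (begin
    u ∙ y                   ≈⟨ ∙-congˡ y≈ ⟩
    u ∙ ((l ⁻¹ ∙ x) ∙ r)    ≈⟨ assoc u _ r ⟨
    (u ∙ (l ⁻¹ ∙ x)) ∙ r    ≈⟨ ∙-congʳ (assoc u (l ⁻¹) x) ⟨
    ((u ∙ l ⁻¹) ∙ x) ∙ r    ≈⟨ ∙-congʳ (∙-congʳ (swap-inverses l'u≈ul)) ⟩
    ((l' ⁻¹ ∙ u) ∙ x) ∙ r   ≈⟨ ∙-congʳ (assoc (l' ⁻¹) u x) ⟩
    (l' ⁻¹ ∙ (u ∙ x)) ∙ r   ∎)

  arc-rightMultiplication : ∀ {u} → PassesRight R u → ∀ {x y} → Arc G L R x y → Arc G L R (x ∙ u) (y ∙ u)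
  arc-rightMultiplication {u} passes {x} {y} (l , r , Ll , Rr , y≈) with passes Rr
  ... | r' , Rr' , ru≈ur' = l , r' , Ll , Rr' , (begin
    y ∙ u                   ≈⟨ ∙-congʳ y≈ ⟩
    ((l ⁻¹ ∙ x) ∙ r) ∙ u    ≈⟨ assoc _ r u ⟩
    (l ⁻¹ ∙ x) ∙ (r ∙ u)    ≈⟨ ∙-congˡ ru≈ur' ⟩
    (l ⁻¹ ∙ x) ∙ (u ∙ r')   ≈⟨ assoc _ u r' ⟨
    ((l ⁻¹ ∙ x) ∙ u) ∙ r'   ≈⟨ ∙-congʳ (assoc (l ⁻¹) x u) ⟩
    (l ⁻¹ ∙ (x ∙ u)) ∙ r'   ∎)

module TwoSidedDigraph {c ℓ p} (G : Group c ℓ) (L R : Pred (Group.Carrier G) p)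
  (l₀ : Group.Carrier G) (l₀∈L : L l₀) (r₀ : Group.Carrier G) (r₀∈R : R r₀) where

  open Group G
  open GroupProperties G
  open GroupFacts G L R
  open Automorphism

  infix 4 _~_
  _~_ : Carrier → Carrier → Set (c ⊔ ℓ ⊔ p)
  _~_ = WeaklyConnected G L R

  ~-refl : ∀ {x} → x ~ x
  ~-refl = EqClosure.reflexive (Arc G L R)

  ~-sym : ∀ {x y} → x ~ y → y ~ x
  ~-sym = EqClosure.symmetric (Arc G L R)

  infixr 5 _⟫_
  _⟫_ : ∀ {x y z} → x ~ y → y ~ z → x ~ z
  _⟫_ = EqClosure.transitive (Arc G L R)

  arc : ∀ {l r x y} → L l → R r → y ≈ (l ⁻¹ ∙ x) ∙ r → x ~ y
  arc Ll Rr y≈ = EqClosure.return (_ , _ , Ll , Rr , y≈)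

  -- equal vertices are weakly connected (both have an arc to l₀⁻¹ x r₀)
  ≈⇒~ : ∀ {x y} → x ≈ y → x ~ y
  ≈⇒~ x≈y = arc l₀∈L r₀∈R refl ⟫ ~-sym (arc l₀∈L r₀∈R (∙-congʳ (∙-congˡ x≈y)))

  arc-resp : ∀ {x x' y y'} → x ≈ x' → y ≈ y' → Arc G L R x y → Arc G L R x' y'
  arc-resp x≈ y≈ (l , r , Ll , Rr , y≈lxr) =
    l , r , Ll , Rr , trans (sym y≈) (trans y≈lxr (∙-congʳ (∙-congˡ x≈)))

  lift : (f : Carrier → Carrier) → (∀ {x y} → Arc G L R x y → f x ~ f y) → f Preserves _~_ ⟶ _~_
  lift f = EqClosure.gfold (EqClosure.isEquivalence (Arc G L R)) f

  σ σ⁻ : Carrier → Carrier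
  σ x = x ∙ r₀
  σ⁻ x = x ∙ r₀ ⁻¹

  σ⁻∘σ : ∀ x → σ⁻ (σ x) ≈ x
  σ⁻∘σ = //-rightDividesʳ r₀

  σ∘σ⁻ : ∀ x → σ (σ⁻ x) ≈ x
  σ∘σ⁻ = //-rightDividesˡ r₀

  L-move : ∀ {l x} → L l → l ∙ x ~ σ x
  L-move {l} {x} Ll = arc Ll r₀∈R (∙-congʳ (sym (\\-leftDividesʳ l x)))

  through : ∀ a x r → a ∙ x ≈ (a ∙ (x ∙ r ⁻¹)) ∙ r
  through a x r = trans (sym (//-rightDividesˡ r (a ∙ x))) (∙-congʳ (assoc a x (r ⁻¹)))

  L⁻¹-move : ∀ {l x} → L l → l ⁻¹ ∙ x ~ σ⁻ x
  L⁻¹-move {l} {x} Ll = ~-sym (arc Ll r₀∈R (through (l ⁻¹) x r₀))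

  -- x r and σ x are both reached from l₀ x
  R-move : ∀ {r x} → R r → x ∙ r ~ σ x
  R-move {r} {x} Rr = ~-sym (arc l₀∈L Rr (∙-congʳ (sym (\\-leftDividesʳ l₀ x)))) ⟫ L-move l₀∈L

  R⁻¹-move : ∀ {r x} → R r → x ∙ r ⁻¹ ~ σ⁻ x
  R⁻¹-move {r} {x} Rr = arc l₀∈L Rr (through (l₀ ⁻¹) x r) ⟫ L⁻¹-move l₀∈L

  -- The shift and its inverse preserve weak connectivity: an arc x → m⁻¹ x s
  -- is matched by σ x ~ x s → m⁻¹ x s r₀, resp. σ⁻ x ~ m⁻¹ x → l₀⁻¹ m⁻¹ x s ~ σ⁻ (m⁻¹ x s).
  σ-preserves : σ Preserves _~_ ⟶ _~_
  σ-preserves = lift σ λ (m , s , Lm , Rs , y≈) →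
    ~-sym (R-move Rs) ⟫ arc Lm r₀∈R (∙-congʳ (trans y≈ (assoc _ _ _)))

  σ⁻-preserves : σ⁻ Preserves _~_ ⟶ _~_
  σ⁻-preserves = lift σ⁻ λ (m , s , Lm , Rs , y≈) →
    ~-sym (L⁻¹-move Lm) ⟫ arc l₀∈L Rs (sym (assoc _ _ _)) ⟫ L⁻¹-move l₀∈L ⟫ ≈⇒~ (∙-congʳ (sym y≈))

  σ-reflects : ∀ {x y} → σ x ~ σ y → x ~ y
  σ-reflects σx~σy = ≈⇒~ (sym (σ⁻∘σ _)) ⟫ σ⁻-preserves σx~σy ⟫ ≈⇒~ (σ⁻∘σ _)

  everywhere : Factorisation → ∀ {q} (P : Pred Carrier q) → (∀ {x y} → x ~ y → P x → P y) →
               (∀ {y} → P y → P (σ y)) → (∀ {y} → P y → P (σ⁻ y)) → P ε → ∀ g → P g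
  everywhere fact P P-~ P-σ P-σ⁻ = generated fact P (λ x≈y → P-~ (≈⇒~ x≈y))
    (λ Ll Py → P-~ (~-sym (L-move Ll)) (P-σ Py))
    (λ Ll Py → P-~ (~-sym (L⁻¹-move Ll)) (P-σ⁻ Py))
    (λ Rr Py → P-~ (~-sym (R-move Rr)) (P-σ Py))
    (λ Rr Py → P-~ (~-sym (R⁻¹-move Rr)) (P-σ⁻ Py))

  shift unshift : ℕ → Carrier → Carrier
  shift n z = fold z σ n
  unshift n z = fold z σ⁻ n

  leftWord : ∀ {q} {S : Pred Carrier q} {f : Carrier → Carrier} → f Preserves _~_ ⟶ _~_ →
             (∀ {s y} → S s → s ∙ y ~ f y) →
             ∀ {n} {ws : Vec Carrier n} → All S ws → ∀ z → prod G ws ∙ z ~ fold z f n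
  leftWord f-pres act [] z = ≈⇒~ (identityˡ z)
  leftWord f-pres act (Sw ∷ Sws) z = ≈⇒~ (assoc _ _ z) ⟫ act Sw ⟫ f-pres (leftWord f-pres act Sws z)

  rightWord : ∀ {q} {S : Pred Carrier q} {f : Carrier → Carrier} → f Preserves _~_ ⟶ _~_ →
              (∀ {s y} → S s → y ∙ s ~ f y) →
              ∀ {n} {ws : Vec Carrier n} → All S ws → ∀ z → z ∙ prod G ws ~ fold z f n
  rightWord f-pres act [] z = ≈⇒~ (identityʳ z)
  rightWord {f = f} f-pres act {suc n} {w ∷ _} (Sw ∷ Sws) z =
    ≈⇒~ (sym (assoc z w _)) ⟫ rightWord f-pres act Sws (z ∙ w)
    ⟫ fold-preserves _~_ f-pres n (act Sw) ⟫ ≈⇒~ (reflexive (fold-commute f z n))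

  L⁻¹-letter : ∀ {w y} → InvSet G L w → w ∙ y ~ σ⁻ y
  L⁻¹-letter (_ , Ls , w≈s⁻¹) = ≈⇒~ (∙-congʳ w≈s⁻¹) ⟫ L⁻¹-move Ls

  R⁻¹-letter : ∀ {w y} → InvSet G R w → y ∙ w ~ σ⁻ y
  R⁻¹-letter (_ , Rs , w≈s⁻¹) = ≈⇒~ (∙-congˡ w≈s⁻¹) ⟫ R⁻¹-move Rs

  unshift-period : ∀ k → unshift k ε ~ ε → shift k ε ~ ε
  unshift-period k period = ~-sym (fold-preserves _~_ σ-preserves k period)
    ⟫ ≈⇒~ (fold-cancel setoid ∙-congʳ σ∘σ⁻ k ε)

  connection⇒period : ∀ {k} → HasWeakConnLength G L R k → shift k ε ~ ε
  connection⇒period (x , inj₁ (_ , Lws , ws≈x) , x~e) =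
    ~-sym (leftWord σ-preserves L-move Lws ε) ⟫ ≈⇒~ (trans (identityʳ _) ws≈x) ⟫ x~e
  connection⇒period {k} (x , inj₂ (inj₁ (_ , L⁻¹ws , ws≈x)) , x~e) = unshift-period k
    (~-sym (leftWord σ⁻-preserves L⁻¹-letter L⁻¹ws ε) ⟫ ≈⇒~ (trans (identityʳ _) ws≈x) ⟫ x~e)
  connection⇒period (x , inj₂ (inj₂ (inj₁ (_ , Rws , ws≈x))) , x~e) =
    ~-sym (rightWord σ-preserves R-move Rws ε) ⟫ ≈⇒~ (trans (identityˡ _) ws≈x) ⟫ x~e
  connection⇒period {k} (x , inj₂ (inj₂ (inj₂ (_ , R⁻¹ws , ws≈x))) , x~e) = unshift-period k
    (~-sym (rightWord σ⁻-preserves R⁻¹-letter R⁻¹ws ε) ⟫ ≈⇒~ (trans (identityˡ _) ws≈x) ⟫ x~e)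

  period⇒connection : ∀ d → shift d ε ~ ε → HasWeakConnLength G L R d
  period⇒connection d period =
    prod G (replicate d r₀) , inj₂ (inj₂ (inj₁ (replicate d r₀ , r₀-word d , refl))) ,
    ≈⇒~ (sym (identityˡ _)) ⟫ rightWord σ-preserves R-move (r₀-word d) ε ⟫ period
    where
    r₀-word : ∀ n → All R (replicate n r₀)
    r₀-word zero = []
    r₀-word (suc n) = r₀∈R ∷ r₀-word n

  separate : ∀ m n → shift m ε ~ shift n ε →
             m ≡.≡ n ⊎ ∃[ d ] (1 ≤ d × d ≤ m ℕ.⊔ n × shift d ε ~ ε)
  separate zero    zero    _     = inj₁ ≡.refl
  separate zero    (suc n) e~σⁿ = inj₂ (suc n , s≤s z≤n , ≤-refl , ~-sym e~σⁿ)
  separate (suc m) zero    σᵐ~e = inj₂ (suc m , s≤s z≤n , ≤-refl , σᵐ~e)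
  separate (suc m) (suc n) σᵐ~σⁿ with separate m n (σ-reflects σᵐ~σⁿ)
  ... | inj₁ m≡n = inj₁ (≡.cong suc m≡n)
  ... | inj₂ (d , 1≤d , d≤ , period) = inj₂ (d , 1≤d , m≤n⇒m≤1+n d≤ , period)

  exactly-k-components : Factorisation → ∀ k → IsMinWeakConnLength G L R k → HasExactlyComponents G L R k
  exactly-k-components fact (suc k′) (_ , connected , minimal) = level , distinct , cover
    where
    period : shift (suc k′) ε ~ ε
    period = connection⇒period connected

    level : Fin (suc k′) → Carrier
    level i = shift (toℕ i) ε

    distinct : ∀ i j → level i ~ level j → i ≡.≡ j
    distinct i j li~lj with separate (toℕ i) (toℕ j) li~lj
    ... | inj₁ i≡j = toℕ-injective i≡j
    ... | inj₂ (d , 1≤d , d≤ , dperiod) =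
      ⊥-elim (minimal d 1≤d (≤-<-trans d≤ (⊔-lub (toℕ<n i) (toℕ<n j))) (period⇒connection d dperiod))

    Covered : Carrier → Set (c ⊔ ℓ ⊔ p)
    Covered y = ∃[ i ] (i < suc k′ × y ~ shift i ε)

    up : ∀ {y} → Covered y → Covered (σ y)
    up (i , i<k , y~) with i ≟ k′
    ... | yes ≡.refl = 0 , z<s , σ-preserves y~ ⟫ period
    ... | no i≢k′ = suc i , s≤s (≤∧≢⇒< (s≤s⁻¹ i<k) i≢k′) , σ-preserves y~

    down : ∀ {y} → Covered y → Covered (σ⁻ y)
    down (zero , _ , y~e) = k′ , ≤-refl , σ⁻-preserves (y~e ⟫ ~-sym period) ⟫ ≈⇒~ (σ⁻∘σ _)
    down (suc i , i<k , y~) = i , <-trans (n<1+n i) i<k , σ⁻-preserves y~ ⟫ ≈⇒~ (σ⁻∘σ _)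

    cover : ∀ g → ∃[ i ] (g ~ level i)
    cover g with everywhere fact Covered (λ x~y (i , i<k , x~) → i , i<k , ~-sym x~y ⟫ x~) up down
                                 (0 , z<s , ~-refl) g
    ... | i , i<k , g~ = fromℕ< i<k , ≡.subst (λ j → g ~ shift j ε) (≡.sym (toℕ-fromℕ< i<k)) g~

  infinitely-many-components : InfiniteWeakConnLength G L R → HasInfinitelyManyComponents G L R
  infinitely-many-components infinite = (λ n → shift n ε) , distinct
    where
    distinct : ∀ m n → shift m ε ~ shift n ε → m ≡.≡ n
    distinct m n σᵐ~σⁿ with separate m n σᵐ~σⁿ
    ... | inj₁ m≡n = m≡n
    ... | inj₂ (d , 1≤d , _ , period) = ⊥-elim (infinite d 1≤d (period⇒connection d period))

  componentBijection : (τ : Automorphism setoid _~_) → ∀ {g h} → τ .to g ~ h → SameSize G L R g h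
  componentBijection τ {g} τg~h = record
    { to = λ (x , x~g) → τ .to x , τ .to-preserves x~g ⟫ τg~h
    ; cong = τ .to-cong
    ; bijective =
        (λ τx≈τy → trans (sym (τ .from-to _)) (trans (τ .from-cong τx≈τy) (τ .from-to _)))
      , λ (y , y~h) → (τ .from y , τ .from-preserves (y~h ⟫ ~-sym τg~h) ⟫ ≈⇒~ (τ .from-to g))
                    , λ z≈ → trans (τ .to-cong z≈) (τ .to-from y)
    }

  weaken : Automorphism setoid (Arc G L R) → Automorphism setoid _~_
  weaken τ .to = τ .to
  weaken τ .from = τ .from
  weaken τ .to-cong = τ .to-cong
  weaken τ .from-cong = τ .from-cong
  weaken τ .from-to = τ .from-to
  weaken τ .to-from = τ .to-from
  weaken τ .to-preserves = lift (τ .to) (λ a → EqClosure.return (τ .to-preserves a))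
  weaken τ .from-preserves = lift (τ .from) (λ a → EqClosure.return (τ .from-preserves a))

  componentIsomorphism : (τ : Automorphism setoid (Arc G L R)) → ∀ {g h} → τ .to g ~ h →
                         IsomorphicComponents G L R g h
  componentIsomorphism τ τg~h = componentBijection (weaken τ) τg~h ,
    λ _ _ → τ .to-preserves , λ a → arc-resp (τ .from-to _) (τ .from-to _) (τ .from-preserves a)

  Shadows : ∀ {r} {Rel : Rel Carrier r} → Automorphism setoid Rel → Set (c ⊔ ℓ ⊔ p)
  Shadows t = (∀ y → σ y ~ t .to y) × (∀ y → σ⁻ y ~ t .from y)

  homogeneous : ∀ {r} {Rel : Rel Carrier r} → Factorisation →
                ((τ : Automorphism setoid Rel) → τ .to Preserves _~_ ⟶ _~_) →
                Σ[ t ∈ Automorphism setoid Rel ] Shadows t →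
                ∀ g h → Σ[ ρ ∈ Automorphism setoid Rel ] ρ .to g ~ h
  homogeneous {Rel = Rel} fact preserves (t , σ~t , σ⁻~t⁻¹) g h = connect (reach g) (reach h)
    where
    -- τh ∘ τg⁻¹ carries g to (about) τg⁻¹ τg e = e and then into the component of h
    connect : Σ[ τ ∈ Automorphism setoid Rel ] τ .to ε ~ g → Σ[ τ ∈ Automorphism setoid Rel ] τ .to ε ~ h →
              Σ[ ρ ∈ Automorphism setoid Rel ] ρ .to g ~ h
    connect (τg , τgε~g) (τh , τhε~h) = τh ∘ᵃ τg ⁻¹ᵃ ,
      preserves τh (preserves (τg ⁻¹ᵃ) (~-sym τgε~g) ⟫ ≈⇒~ (τg .from-to ε)) ⟫ τhε~h

    reach : ∀ g → Σ[ τ ∈ Automorphism setoid Rel ] τ .to ε ~ g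
    reach = everywhere fact _ (λ x~y (τ , τε~x) → τ , τε~x ⟫ x~y)
      (λ (τ , τε~y) → t ∘ᵃ τ , ~-sym (σ~t _) ⟫ σ-preserves τε~y)
      (λ (τ , τε~y) → t ⁻¹ᵃ ∘ᵃ τ , ~-sym (σ⁻~t⁻¹ _) ⟫ σ⁻-preserves τε~y)
      (idᵃ , ~-refl)

  shiftAutomorphism : Automorphism setoid _~_
  shiftAutomorphism .to = σ
  shiftAutomorphism .from = σ⁻
  shiftAutomorphism .to-cong = ∙-congʳ
  shiftAutomorphism .from-cong = ∙-congʳ
  shiftAutomorphism .from-to = σ⁻∘σ
  shiftAutomorphism .to-from = σ∘σ⁻
  shiftAutomorphism .to-preserves = σ-preserves
  shiftAutomorphism .from-preserves = σ⁻-preserves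

  same-size : Factorisation → ∀ g h → SameSize G L R g h
  same-size fact g h with homogeneous fact to-preserves (shiftAutomorphism , (λ _ → ~-refl) , (λ _ → ~-refl)) g h
  ... | ρ , ρg~h = componentBijection ρ ρg~h

  normalisingAutomorphism : (Σ[ x ∈ Carrier ] (L x × Normalizer G L x) ⊎ Σ[ x ∈ Carrier ] (R x × Normalizer G R x)) →
                            Σ[ t ∈ Automorphism setoid (Arc G L R) ] Shadows t
  normalisingAutomorphism (inj₁ (n , Ln , normal)) = t , (λ _ → ~-sym (L-move Ln)) , (λ _ → ~-sym (L⁻¹-move Ln))
    where
    t : Automorphism setoid (Arc G L R)
    t .to = n ∙_
    t .from = n ⁻¹ ∙_
    t .to-cong = ∙-congˡ
    t .from-cong = ∙-congˡ
    t .from-to = \\-leftDividesʳ n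
    t .to-from = \\-leftDividesˡ n
    t .to-preserves = arc-leftMultiplication (normaliser-passesLeft normal)
    t .from-preserves = arc-leftMultiplication (normaliser⁻¹-passesLeft normal)
  normalisingAutomorphism (inj₂ (m , Rm , normal)) = t , (λ _ → ~-sym (R-move Rm)) , (λ _ → ~-sym (R⁻¹-move Rm))
    where
    t : Automorphism setoid (Arc G L R)
    t .to = _∙ m
    t .from = _∙ m ⁻¹
    t .to-cong = ∙-congʳ
    t .from-cong = ∙-congʳ
    t .from-to = //-rightDividesʳ m
    t .to-from = //-rightDividesˡ m
    t .to-preserves = arc-rightMultiplication (normaliser-passesRight normal)
    t .from-preserves = arc-rightMultiplication (normaliser⁻¹-passesRight normal)

  isomorphic-components : Factorisation →
    (Σ[ x ∈ Carrier ] (L x × Normalizer G L x) ⊎ Σ[ x ∈ Carrier ] (R x × Normalizer G R x)) →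
    ∀ g h → IsomorphicComponents G L R g h
  isomorphic-components fact normal g h
    with homogeneous fact (λ τ → weaken τ .to-preserves) (normalisingAutomorphism normal) g h
  ... | ρ , ρg~h = componentIsomorphism ρ ρg~h

theorem3p13 : {c ℓ p : Level} (G : Group c ℓ) (L R : Pred (Group.Carrier G) p) →
    IsSubset G L → IsSubset G R →
    Σ[ l ∈ Group.Carrier G ] L l → Σ[ r ∈ Group.Carrier G ] R r →
    ((g : Group.Carrier G) → Σ[ a ∈ Group.Carrier G ] Σ[ b ∈ Group.Carrier G ] (𝒲 G (Bar G L) a × 𝒲 G (Bar G R) b
                          × Group._≈_ G g (Group._∙_ G a b))) →
    ((k : ℕ) → IsMinWeakConnLength G L R k → HasExactlyComponents G L R k)
    × (InfiniteWeakConnLength G L R → HasInfinitelyManyComponents G L R)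
    × (∀ g h → SameSize G L R g h)
    × ((Σ[ x ∈ Group.Carrier G ] (L x × Normalizer G L x) ⊎ Σ[ x ∈ Group.Carrier G ] (R x × Normalizer G R x)) →
       ∀ g h → IsomorphicComponents G L R g h)
theorem3p13 G L R _ _ (l₀ , l₀∈L) (r₀ , r₀∈R) fact =
    exactly-k-components fact
  , infinitely-many-components
  , same-size fact
  , isomorphic-components fact
  where open TwoSidedDigraph G L R l₀ l₀∈L r₀ r₀∈R
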